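{- Let $x, y \in \{0,1\}^+$ be nonempty binary words with $y$ overlap-free, and let $a, b \in \{0,1\}$ be letters. If $a\, x x\, b = \mu(y)$, then $x \in \{0, 1, 010, 101\}$.
   Context: $\mu$ is the Thue–Morse morphism on $\{0,1\}^*$, defined by $\mu(0) = 01$, $\mu(1) = 10$ and extended to words by concatenation. An overlap is a word of the form $cxcxc$ with $c$ a single letter and $x$ a possibly empty word; a word is overlap-free if no factor (contiguous subword) of it is an overlap. -}

module Defs where

open import Data.Bool using (Bool; true; false; not)
open import Data.List using (List; []; _∷_; _++_; concatMap)
open import Data.Product using (∃-syntax; _×_)
open import Relation.Binary.PropositionalEquality using (_≡_)
open import Relation.Nullary using (¬_)

-- Binary alphabet {0,1}: 0 is false, 1 is true.
Letter : Set
Letter = Bool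

Word : Set
Word = List Letter

μ₁ : Letter → Word
μ₁ c = c ∷ not c ∷ []

μ : Word → Word
μ [] = []
μ (c ∷ w) = μ₁ c ++ μ w

IsOverlap : Word → Set
IsOverlap w = ∃[ c ] ∃[ x ] (w ≡ c ∷ x ++ c ∷ x ++ c ∷ [])

Factor : Word → Word → Set
Factor f w = ∃[ u ] ∃[ v ] (w ≡ u ++ f ++ v)

OverlapFree : Word → Set
OverlapFree w = ∀ f → Factor f w → ¬ IsOverlap f

NonEmpty : Word → Set
NonEmpty w = ¬ (w ≡ [])

-- Write y = e y'. Then a = e, x = (not e) x' and x' (not e) x' b = μ(y'). Cut μ(y') after x'.
-- If the cut falls inside a block μ(c), then comparing the two sides forces y = c z c z c,
-- an overlap. If it falls between blocks, x' = μ(z) and (not e) μ(z) b is again a μ-image;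
-- reading it two letters at a time shows z = eⁿ, and y begins with e eⁿ, so n ≤ 1 since
-- y has no factor eee. The cases n = 0, 1 give x = 0, 1, 010, 101.
module Submission where

open import Defs
open import Data.Bool using (true; false; not)
open import Data.Bool.Properties using (not-injective; not-involutive)
open import Data.List using ([]; _∷_; _++_; replicate)
open import Data.List.Properties using (∷-injective; ++-assoc; ++-identityʳ)
open import Data.Nat using (zero; suc)
open import Data.Product using (∃-syntax; _×_; _,_; proj₂)
open import Data.Sum using (_⊎_; inj₁; inj₂)
open import Data.Empty using (⊥-elim)
open import Relation.Binary.PropositionalEquality using (_≡_; refl; sym; trans; cong)
open import Relation.Nullary using (¬_)

data μ-Split (z u v : Word) : Set where
  betweenBlocks : ∀ z₁ z₂ → z ≡ z₁ ++ z₂ → u ≡ μ z₁ → v ≡ μ z₂ → μ-Split z u v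
  insideBlock   : ∀ z₁ c z₂ → z ≡ z₁ ++ c ∷ z₂ → u ≡ μ z₁ ++ c ∷ [] → v ≡ not c ∷ μ z₂
                → μ-Split z u v

μ-split : ∀ z u v → μ z ≡ u ++ v → μ-Split z u v
μ-split z [] v eq = betweenBlocks [] z refl refl (sym eq)
μ-split [] (p ∷ u) v ()
μ-split (c ∷ z) (p ∷ []) v eq with ∷-injective eq
... | refl , eq′ = insideBlock [] c z refl refl (sym eq′)
μ-split (c ∷ z) (p ∷ q ∷ u) v eq with ∷-injective eq
... | refl , eq′ with ∷-injective eq′
... | refl , eq″ with μ-split z u v eq″
... | betweenBlocks z₁ z₂ r₁ r₂ r₃ =
  betweenBlocks (c ∷ z₁) z₂ (cong (c ∷_) r₁) (cong (μ₁ c ++_) r₂) r₃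
... | insideBlock z₁ d z₂ r₁ r₂ r₃ =
  insideBlock (c ∷ z₁) d z₂ (cong (c ∷_) r₁) (cong (μ₁ c ++_) r₂) r₃

μ-cancelˡ : ∀ z w u → μ z ++ u ≡ μ w → ∃[ v ] (w ≡ z ++ v × u ≡ μ v)
μ-cancelˡ []      w       u eq = w , refl , eq
μ-cancelˡ (c ∷ z) []      u ()
μ-cancelˡ (c ∷ z) (d ∷ w) u eq with ∷-injective eq
... | refl , eq′ with μ-cancelˡ z w u (proj₂ (∷-injective eq′))
... | v , refl , u≡μv = v , refl , u≡μv

μ-preimage-μ₁ : ∀ v c b → c ∷ b ∷ [] ≡ μ v → v ≡ c ∷ []
μ-preimage-μ₁ []           c b ()
μ-preimage-μ₁ (d ∷ [])     c b eq with ∷-injective eq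
... | refl , _ = refl
μ-preimage-μ₁ (d ∷ d′ ∷ v) c b eq with ∷-injective eq
... | _ , eq′ with ∷-injective eq′
... | _ , ()

shifted-μ-image⇒constant : ∀ d z b w → not d ∷ μ z ++ b ∷ [] ≡ μ w → ∃[ n ] z ≡ replicate n d
shifted-μ-image⇒constant d []       b w eq = 0 , refl
shifted-μ-image⇒constant d (d′ ∷ z) b []      ()
shifted-μ-image⇒constant d (d′ ∷ z) b (f ∷ w) eq with ∷-injective eq
... | refl , eq′ with ∷-injective eq′
... | d′≡¬¬d , eq″ with trans d′≡¬¬d (not-involutive d)
... | refl with shifted-μ-image⇒constant d z b w eq″
... | n , refl = suc n , refl

overlapFree⇒¬overlap : ∀ {w} → OverlapFree w → ¬ IsOverlap w
overlapFree⇒¬overlap {w} of = of w ([] , [] , sym (++-identityʳ w))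

overlapFree⇒¬cube : ∀ e r → ¬ OverlapFree (e ∷ e ∷ e ∷ r)
overlapFree⇒¬cube e r of = of (e ∷ e ∷ e ∷ []) ([] , r , refl) (e , [] , refl)

Short : Word → Set
Short x = (x ≡ false ∷ []) ⊎ (x ≡ true ∷ []) ⊎ (x ≡ false ∷ true ∷ false ∷ []) ⊎ (x ≡ true ∷ false ∷ true ∷ [])

short-block : ∀ e n r → OverlapFree (e ∷ replicate n e ++ r) → Short (not e ∷ μ (replicate n e))
short-block false zero          r of = inj₂ (inj₁ refl)
short-block true  zero          r of = inj₁ refl
short-block false (suc zero)    r of = inj₂ (inj₂ (inj₂ refl))
short-block true  (suc zero)    r of = inj₂ (inj₂ (inj₁ refl))
short-block e     (suc (suc n)) r of = ⊥-elim (overlapFree⇒¬cube e _ of)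

insideBlock-square⇒overlap : ∀ e z₁ c z₂ b → not e ∷ (μ z₁ ++ c ∷ []) ++ b ∷ [] ≡ not c ∷ μ z₂
                           → IsOverlap (e ∷ z₁ ++ c ∷ z₂)
insideBlock-square⇒overlap e z₁ c z₂ b eq with ∷-injective eq
... | ¬e≡¬c , eq′ with not-injective ¬e≡¬c
... | refl with μ-cancelˡ z₁ z₂ (c ∷ b ∷ []) (trans (sym (++-assoc (μ z₁) _ _)) eq′)
... | v , refl , cb≡μv with μ-preimage-μ₁ v c b cb≡μv
... | refl = c , z₁ , refl

lemma5 : (x y : Word) (a b : Letter) → NonEmpty x → NonEmpty y → OverlapFree y
    → a ∷ x ++ x ++ b ∷ [] ≡ μ y
    → (x ≡ false ∷ []) ⊎ (x ≡ true ∷ []) ⊎ (x ≡ false ∷ true ∷ false ∷ []) ⊎ (x ≡ true ∷ false ∷ true ∷ [])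
lemma5 []       y        a b x≢[] _ _ _ = ⊥-elim (x≢[] refl)
lemma5 (_ ∷ x′) []       a b _ _ _ ()
lemma5 (_ ∷ x′) (e ∷ y′) a b _ _ of eq with ∷-injective eq
... | refl , eq′ with ∷-injective eq′
... | refl , eq″ with μ-split y′ x′ _ (sym eq″)
... | insideBlock z₁ c z₂ refl refl eq‴ =
  ⊥-elim (overlapFree⇒¬overlap of (insideBlock-square⇒overlap e z₁ c z₂ b eq‴))
... | betweenBlocks z₁ z₂ refl refl eq‴ with shifted-μ-image⇒constant e z₁ b z₂ eq‴
... | n , refl = short-block e n z₂ of
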